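{- For every positive integer $n$, $$\Phi^{(1)}[aq^n; b, b'; c; x, y] = \Phi^{(1)}[a; b, b'; c; x, y] + \frac{ax(1-b)}{1-c} \sum_{k=1}^n q^{k-1} \Phi^{(1)}[aq^k; bq, b'; cq; x, y] + \frac{ay(1-b')}{1-c} \sum_{k=1}^n q^{k-1} \Phi^{(1)}[aq^k; b, b'q; cq; xq, y],$$ and $$\Phi^{(1)}[aq^{ -n}; b, b'; c; x, y] = \Phi^{(1)}[a; b, b'; c; x, y] - \frac{ax(1-b)}{1-c} \sum_{k=1}^n q^{ -k} \Phi^{(1)}[aq^{1-k}; bq, b'; cq; x, y] - \frac{ay(1-b')}{1-c} \sum_{k=1}^n q^{ -k} \Phi^{(1)}[aq^{1-k}; b, b'q; cq; xq, y].$$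
   Context: Let $q$ be a complex number with $|q|<1$. For a complex number $z$ and an integer $N\ge 0$, $(z;q)_N=\prod_{j=0}^{N-1}(1-zq^j)$. The $q$-Appell function $\Phi^{(1)}$ is $$\Phi^{(1)}[a; b, b'; c; x, y] = \sum_{m, n \geq 0} \frac{(a; q)_{m+n} (b; q)_m (b'; q)_n}{(q; q)_m (q; q)_n (c; q)_{m+n}} x^m y^n .$$ All identities are understood as identities of power series in $x,y$ (convergent for $|x|,|y|$ sufficiently small), with parameters generic so that no denominator appearing vanishes. -}

module Defs where

open import Level using (Level; _⊔_) renaming (suc to lsuc)
open import Data.Nat using (ℕ; zero; suc) renaming (_+_ to _+ℕ_)
open import Relation.Nullary using (¬_)
open import Algebra.Bundles using (CommutativeRing)

-- A field, presented as a commutative ring with a total inverse map that is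
-- a genuine inverse on nonzero elements (the value at 0 is irrelevant).
-- (agda-stdlib 2.3 has no Field bundle.)
record Field (c ℓ : Level) : Set (lsuc (c ⊔ ℓ)) where
  field
    commutativeRing : CommutativeRing c ℓ
  open CommutativeRing commutativeRing public
  field
    _⁻¹        : Carrier → Carrier
    ⁻¹-inverse : ∀ x → ¬ (x ≈ 0#) → x * (x ⁻¹) ≈ 1#
    0≉1        : ¬ (0# ≈ 1#)

module QAppell {c ℓ : Level} (F : Field c ℓ) where
  open Field F

  pow : Carrier → ℕ → Carrier
  pow x zero    = 1#
  pow x (suc n) = x * pow x n

  poch : Carrier → Carrier → ℕ → Carrier
  poch z q zero    = 1#
  poch z q (suc N) = poch z q N * (1# - z * pow q N)

  -- formal power series in x, y: (m , n) ↦ coefficient of x^m y^n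
  PS : Set c
  PS = ℕ → ℕ → Carrier

  _≋_ : PS → PS → Set ℓ
  f ≋ g = ∀ m n → f m n ≈ g m n

  _⊕_ : PS → PS → PS
  (f ⊕ g) m n = f m n + g m n

  _⊖_ : PS → PS → PS
  (f ⊖ g) m n = f m n - g m n

  zeroPS : PS
  zeroPS m n = 0#

  scale : Carrier → PS → PS
  scale s f m n = s * f m n

  mulX : PS → PS
  mulX f zero    n = 0#
  mulX f (suc m) n = f m n

  mulY : PS → PS
  mulY f m zero    = 0#
  mulY f m (suc n) = f m n

  substXq : Carrier → PS → PS
  substXq q f m n = pow q m * f m n

  sumFrom1 : ℕ → (ℕ → PS) → PS
  sumFrom1 zero    G = zeroPS
  sumFrom1 (suc n) G = sumFrom1 n G ⊕ G (suc n)

  Φ1 : (q a b b' c : Carrier) → PS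
  Φ1 q a b b' c m n =
    (poch a q (m +ℕ n) * poch b q m * poch b' q n)
    * (poch q q m * poch q q n * poch c q (m +ℕ n)) ⁻¹

module Submission where

open import Defs
open import Level using (Level)
open import Data.Nat using (ℕ; _≤_; _∸_; zero; suc; pred) renaming (_+_ to _+ℕ_)
open import Data.Nat.Properties using (+-suc)
open import Data.Product using (_×_; _,_)
open import Relation.Nullary using (¬_)
import Relation.Binary.PropositionalEquality as P

-- Proof idea.  Everything reduces to the one-step contiguous relation
--
--   Φ[Aq; b, b'; c; x, y] = Φ[A; b, b'; c; x, y]
--       + A(1-b)/(1-c) · x · Φ[Aq; bq, b'; cq; x, y]
--       + A(1-b')/(1-c) · y · Φ[Aq; b, b'q; cq; xq, y],
--
-- proved coefficientwise.  Over the common denominator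
-- D(m,n) = (q;q)_m (q;q)_n (c;q)_{m+n}, the coefficient of x^m y^n splits
-- because (Aq;q)_N - (A;q)_N = A(1-q^N)(Aq;q)_{N-1} and
-- 1 - q^{m+n} = (1 - q^m) + q^m (1 - q^n); the two pieces are exactly the
-- x- and y-terms after extracting the first factor of (b;q), (b';q), (c;q).
-- The identity for a q^n follows by induction on n, applying the relation
-- with A = a q^(n-1); the identity for a q^(-n) likewise, applying it with
-- A = a q^(-n) and solving for Φ[A].

module Contiguity {c ℓ : Level} (F : Field c ℓ) where
  open Field F hiding (zero)
  open QAppell F
  open import Algebra.Solver.Ring.NaturalCoefficients.Default commutativeSemiring
  open import Algebra.Properties.Ring ring using (-‿distribʳ-*; -0#≈0#)
  open import Algebra.Properties.AbelianGroup +-abelianGroup using (⁻¹-∙-comm)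
  open import Relation.Binary.Reasoning.Setoid setoid

  inverse-unique : ∀ x z → x * z ≈ 1# → z ≈ x ⁻¹
  inverse-unique x z xz≈1 = begin
    z                  ≈⟨ *-identityʳ z ⟨
    z * 1#             ≈⟨ *-congˡ (⁻¹-inverse x x≉0) ⟨
    z * (x * x ⁻¹)     ≈⟨ solve 3 (λ z x w → z :* (x :* w) := (x :* z) :* w) refl z x (x ⁻¹) ⟩
    (x * z) * x ⁻¹     ≈⟨ *-congʳ xz≈1 ⟩
    1# * x ⁻¹          ≈⟨ *-identityˡ (x ⁻¹) ⟩
    x ⁻¹ ∎
    where
    x≉0 : ¬ (x ≈ 0#)
    x≉0 x≈0 = 0≉1 (trans (sym (trans (*-congʳ x≈0) (zeroˡ z))) xz≈1)

  nonzero-* : ∀ x y → ¬ (x ≈ 0#) → ¬ (y ≈ 0#) → ¬ (x * y ≈ 0#)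
  nonzero-* x y x≉0 y≉0 xy≈0 = y≉0 (begin
    y                  ≈⟨ *-identityˡ y ⟨
    1# * y             ≈⟨ *-congʳ (⁻¹-inverse x x≉0) ⟨
    (x * x ⁻¹) * y     ≈⟨ solve 3 (λ x w y → (x :* w) :* y := w :* (x :* y)) refl x (x ⁻¹) y ⟩
    x ⁻¹ * (x * y)     ≈⟨ *-congˡ xy≈0 ⟩
    x ⁻¹ * 0#          ≈⟨ zeroʳ (x ⁻¹) ⟩
    0# ∎)

  -- Rewriting 1/(E₁E₂) over a larger denominator: if D = E₁ E₂ t ≠ 0 then
  -- E₁⁻¹ E₂⁻¹ = t / D.  This brings the x- and y-terms over D(m,n).
  inverses-over : ∀ D E₁ E₂ t → ¬ (D ≈ 0#) → D ≈ (E₁ * E₂) * t →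
                  E₁ ⁻¹ * E₂ ⁻¹ ≈ t * D ⁻¹
  inverses-over D E₁ E₂ t D≉0 D≈E₁E₂t = begin
    E₁ ⁻¹ * E₂ ⁻¹                             ≈⟨ *-cong (sym E₁⁻¹≈) (sym E₂⁻¹≈) ⟩
    (E₂ * (t * D ⁻¹)) * (E₁ * (t * D ⁻¹))     ≈⟨ solve 4 (λ e₁ e₂ t d → (e₂ :* (t :* d)) :* (e₁ :* (t :* d)) := ((e₁ :* e₂) :* t :* d) :* (t :* d)) refl E₁ E₂ t (D ⁻¹) ⟩
    ((E₁ * E₂) * t * D ⁻¹) * (t * D ⁻¹)       ≈⟨ *-congʳ D/D≈1 ⟩
    1# * (t * D ⁻¹)                           ≈⟨ *-identityˡ _ ⟩
    t * D ⁻¹ ∎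
    where
    D/D≈1 : (E₁ * E₂) * t * D ⁻¹ ≈ 1#
    D/D≈1 = trans (*-congʳ (sym D≈E₁E₂t)) (⁻¹-inverse D D≉0)
    E₁⁻¹≈ : E₂ * (t * D ⁻¹) ≈ E₁ ⁻¹
    E₁⁻¹≈ = inverse-unique E₁ _ (trans (solve 4 (λ e₁ e₂ t d → e₁ :* (e₂ :* (t :* d)) := (e₁ :* e₂) :* t :* d) refl E₁ E₂ t (D ⁻¹)) D/D≈1)
    E₂⁻¹≈ : E₁ * (t * D ⁻¹) ≈ E₂ ⁻¹
    E₂⁻¹≈ = inverse-unique E₂ _ (trans (solve 4 (λ e₁ e₂ t d → e₂ :* (e₁ :* (t :* d)) := (e₁ :* e₂) :* t :* d) refl E₁ E₂ t (D ⁻¹)) D/D≈1)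

  one-minus-product : ∀ x y → (1# - x) + x * (1# - y) ≈ 1# - x * y
  one-minus-product x y = begin
    (1# - x) + x * (1# - y)              ≈⟨ +-congˡ (distribˡ x 1# (- y)) ⟩
    (1# + - x) + (x * 1# + x * - y)      ≈⟨ +-congˡ (+-cong (*-identityʳ x) (sym (-‿distribʳ-* x y))) ⟩
    (1# + - x) + (x + - (x * y))         ≈⟨ solve 4 (λ o nx x nxy → (o :+ nx) :+ (x :+ nxy) := o :+ (nx :+ x) :+ nxy) refl 1# (- x) x (- (x * y)) ⟩
    1# + (- x + x) + - (x * y)           ≈⟨ +-congʳ (+-congˡ (-‿inverseˡ x)) ⟩
    1# + 0# + - (x * y)                  ≈⟨ +-congʳ (+-identityʳ 1#) ⟩
    1# - x * y ∎

  one-minus-one-* : ∀ u v → u * (1# - 1#) * v ≈ 0#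
  one-minus-one-* u v = trans (*-congʳ (trans (*-congˡ (-‿inverseʳ 1#)) (zeroʳ u))) (zeroˡ v)

  solve-for-first : ∀ x u v z → z ≈ (x + u) + v → x ≈ (z - u) - v
  solve-for-first x u v z z≈ = sym (begin
    (z - u) - v                        ≈⟨ +-congʳ (+-congʳ z≈) ⟩
    (((x + u) + v) + - u) + - v        ≈⟨ solve 5 (λ x u v nu nv → (((x :+ u) :+ v) :+ nu) :+ nv := x :+ (u :+ nu) :+ (v :+ nv)) refl x u v (- u) (- v) ⟩
    x + (u + - u) + (v + - v)          ≈⟨ +-cong (+-congˡ (-‿inverseʳ u)) (-‿inverseʳ v) ⟩
    x + 0# + 0#                        ≈⟨ trans (+-identityʳ _) (+-identityʳ x) ⟩
    x ∎)

  neg-distrib-scaled : ∀ s p M X sp → sp ≈ s * p → - (s * (M + p * X)) ≈ - (s * M) + - (sp * X)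
  neg-distrib-scaled s p M X sp sp≈ =
    trans (-‿cong (trans (distribˡ s M (p * X)) (+-congˡ (trans (sym (*-assoc s p X)) (*-congʳ (sym sp≈))))))
          (sym (⁻¹-∙-comm _ _))

  pow-+ : ∀ x m n → pow x (m +ℕ n) ≈ pow x m * pow x n
  pow-+ x zero    n = sym (*-identityˡ _)
  pow-+ x (suc m) n = trans (*-congˡ (pow-+ x m n)) (sym (*-assoc _ _ _))

  poch-cong : ∀ {z z'} q N → z ≈ z' → poch z q N ≈ poch z' q N
  poch-cong q zero    z≈z' = refl
  poch-cong q (suc N) z≈z' = *-cong (poch-cong q N z≈z') (+-congˡ (-‿cong (*-congʳ z≈z')))

  poch-first : ∀ z q N → poch z q (suc N) ≈ (1# - z) * poch (z * q) q N
  poch-first z q zero = begin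
    1# * (1# - z * 1#)  ≈⟨ *-identityˡ _ ⟩
    1# - z * 1#         ≈⟨ +-congˡ (-‿cong (*-identityʳ z)) ⟩
    1# - z              ≈⟨ *-identityʳ _ ⟨
    (1# - z) * 1# ∎
  poch-first z q (suc N) = begin
    poch z q (suc N) * (1# - z * (q * pow q N))               ≈⟨ *-cong (poch-first z q N) (+-congˡ (-‿cong (sym (*-assoc z q (pow q N))))) ⟩
    ((1# - z) * poch (z * q) q N) * (1# - (z * q) * pow q N)  ≈⟨ *-assoc _ _ _ ⟩
    (1# - z) * poch (z * q) q (suc N) ∎

  poch-difference : ∀ A q N →
    poch (A * q) q N ≈ poch A q N + A * (1# - pow q N) * poch (A * q) q (pred N)
  poch-difference A q zero = sym (trans (+-congˡ (one-minus-one-* A 1#)) (+-identityʳ 1#))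
  poch-difference A q (suc K) = begin
    P' * (1# - (A * q) * pow q K)                 ≈⟨ *-congˡ (+-congˡ (-‿cong (*-assoc A q (pow q K)))) ⟩
    P' * (1# - A * (q * pow q K))                ≈⟨ *-congˡ (one-minus-product A (q * pow q K)) ⟨
    P' * ((1# - A) + A * (1# - q * pow q K))     ≈⟨ solve 4 (λ p u a v → p :* (u :+ a :* v) := u :* p :+ a :* v :* p) refl P' (1# - A) A (1# - q * pow q K) ⟩
    (1# - A) * P' + A * (1# - q * pow q K) * P'  ≈⟨ +-congʳ (poch-first A q K) ⟨
    poch A q (suc K) + A * (1# - pow q (suc K)) * P' ∎
    where P' = poch (A * q) q K

  Φ1-cong : ∀ {A A'} q b b' c → A ≈ A' → Φ1 q A b b' c ≋ Φ1 q A' b b' c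
  Φ1-cong q b b' c A≈A' m n = *-congʳ (*-congʳ (*-congʳ (poch-cong q (m +ℕ n) A≈A')))

  mulX-cong : ∀ {f g} → f ≋ g → mulX f ≋ mulX g
  mulX-cong f≋g zero    n = refl
  mulX-cong f≋g (suc m) n = f≋g m n

  mulY-cong : ∀ {f g} → f ≋ g → mulY f ≋ mulY g
  mulY-cong f≋g m zero    = refl
  mulY-cong f≋g m (suc n) = f≋g m n

  substXq-cong : ∀ q {f g} → f ≋ g → substXq q f ≋ substXq q g
  substXq-cong q f≋g m n = *-congˡ (f≋g m n)

  mulX-⊕-scale : ∀ f g s → mulX (f ⊕ scale s g) ≋ (mulX f ⊕ scale s (mulX g))
  mulX-⊕-scale f g s zero    n = sym (trans (+-identityˡ _) (zeroʳ s))
  mulX-⊕-scale f g s (suc m) n = refl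

  mulY-⊕-scale : ∀ f g s → mulY (f ⊕ scale s g) ≋ (mulY f ⊕ scale s (mulY g))
  mulY-⊕-scale f g s m zero    = sym (trans (+-identityˡ _) (zeroʳ s))
  mulY-⊕-scale f g s m (suc n) = refl

  scale-mulX-zero : ∀ s → scale s (mulX zeroPS) ≋ zeroPS
  scale-mulX-zero s zero    n = zeroʳ s
  scale-mulX-zero s (suc m) n = zeroʳ s

  scale-mulY-zero : ∀ s → scale s (mulY zeroPS) ≋ zeroPS
  scale-mulY-zero s m zero    = zeroʳ s
  scale-mulY-zero s m (suc n) = zeroʳ s

  module Contiguous (q b b' c : Carrier)
                    (Qq≉0 : ∀ m → ¬ (poch q q m ≈ 0#))
                    (Cq≉0 : ∀ N → ¬ (poch c q N ≈ 0#)) where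

    D : ℕ → ℕ → Carrier
    D m n = poch q q m * poch q q n * poch c q (m +ℕ n)

    D≉0 : ∀ m n → ¬ (D m n ≈ 0#)
    D≉0 m n = nonzero-* _ _ (nonzero-* _ _ (Qq≉0 m) (Qq≉0 n)) (Cq≉0 (m +ℕ n))

    λx λy : Carrier → Carrier
    λx A = (A * (1# - b)) * (1# - c) ⁻¹
    λy A = (A * (1# - b')) * (1# - c) ⁻¹

    Φx Φy : Carrier → PS
    Φx A = Φ1 q (A * q) (b * q) b' (c * q)
    Φy A = Φ1 q (A * q) b (b' * q) (c * q)

    -- The x-term, over the denominator D(m,n); the factor 1 - q^m
    -- makes it vanish for m = 0.
    x-term : ∀ A m n →
      λx A * mulX (Φx A) m n
        ≈ (A * (1# - pow q m) * poch (A * q) q (pred (m +ℕ n)) * poch b q m * poch b' q n) * D m n ⁻¹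
    x-term A zero n = trans (zeroʳ _) (sym (trans (*-congʳ (*-congʳ (*-congʳ (one-minus-one-* A _)))) (solve 3 (λ u v d → (con 0 :* u :* v) :* d := con 0) refl _ _ _)))
    x-term A (suc m) n = begin
      ((A * (1# - b)) * (1# - c) ⁻¹) * ((P' * Pbq * B') * E ⁻¹)
        ≈⟨ solve 6 (λ s ci p pb b' ei → (s :* ci) :* ((p :* pb :* b') :* ei) := s :* (p :* pb :* b') :* (ci :* ei)) refl (A * (1# - b)) ((1# - c) ⁻¹) P' Pbq B' (E ⁻¹) ⟩
      (A * (1# - b)) * (P' * Pbq * B') * ((1# - c) ⁻¹ * E ⁻¹)
        ≈⟨ *-congˡ (inverses-over (D (suc m) n) (1# - c) E t (D≉0 (suc m) n) D≈) ⟩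
      (A * (1# - b)) * (P' * Pbq * B') * (t * D (suc m) n ⁻¹)
        ≈⟨ solve 7 (λ a u p pb b' t d → (a :* u) :* (p :* pb :* b') :* (t :* d) := (a :* t :* p :* (u :* pb) :* b') :* d) refl A (1# - b) P' Pbq B' t (D (suc m) n ⁻¹) ⟩
      (A * t * P' * ((1# - b) * Pbq) * B') * D (suc m) n ⁻¹
        ≈⟨ *-congʳ (*-congʳ (*-congˡ (poch-first b q m))) ⟨
      (A * t * P' * poch b q (suc m) * B') * D (suc m) n ⁻¹ ∎
      where
      P' = poch (A * q) q (m +ℕ n)
      Pbq = poch (b * q) q m
      B' = poch b' q n
      E = poch q q m * poch q q n * poch (c * q) q (m +ℕ n)
      t = 1# - q * pow q m
      D≈ : D (suc m) n ≈ ((1# - c) * E) * t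
      D≈ = trans (*-congˡ (poch-first c q (m +ℕ n)))
        (solve 5 (λ qm t qn u pc → qm :* t :* qn :* (u :* pc) := (u :* (qm :* qn :* pc)) :* t) refl
          (poch q q m) t (poch q q n) (1# - c) (poch (c * q) q (m +ℕ n)))

    -- The y-term for n ≥ 1, where the index m + n of (Aq;q) is m + (n - 1) + 1.
    y-term-suc : ∀ A m n →
      λy A * mulY (substXq q (Φy A)) m (suc n)
        ≈ (A * pow q m * (1# - pow q (suc n)) * poch (A * q) q (m +ℕ n) * poch b q m * poch b' q (suc n)) * D m (suc n) ⁻¹
    y-term-suc A m n = begin
      ((A * (1# - b')) * (1# - c) ⁻¹) * (qm * ((P' * Bm * Pbq) * E ⁻¹))
        ≈⟨ solve 7 (λ s ci qm p bm pb ei → (s :* ci) :* (qm :* ((p :* bm :* pb) :* ei)) := s :* (qm :* (p :* bm :* pb)) :* (ci :* ei)) refl (A * (1# - b')) ((1# - c) ⁻¹) qm P' Bm Pbq (E ⁻¹) ⟩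
      (A * (1# - b')) * (qm * (P' * Bm * Pbq)) * ((1# - c) ⁻¹ * E ⁻¹)
        ≈⟨ *-congˡ (inverses-over (D m (suc n)) (1# - c) E t (D≉0 m (suc n)) D≈) ⟩
      (A * (1# - b')) * (qm * (P' * Bm * Pbq)) * (t * D m (suc n) ⁻¹)
        ≈⟨ solve 8 (λ a u qm p bm pb t d → (a :* u) :* (qm :* (p :* bm :* pb)) :* (t :* d) := (a :* qm :* t :* p :* bm :* (u :* pb)) :* d) refl A (1# - b') qm P' Bm Pbq t (D m (suc n) ⁻¹) ⟩
      (A * qm * t * P' * Bm * ((1# - b') * Pbq)) * D m (suc n) ⁻¹
        ≈⟨ *-congʳ (*-congˡ (poch-first b' q n)) ⟨
      (A * qm * t * P' * Bm * poch b' q (suc n)) * D m (suc n) ⁻¹ ∎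
      where
      qm = pow q m
      P' = poch (A * q) q (m +ℕ n)
      Bm = poch b q m
      Pbq = poch (b' * q) q n
      E = poch q q m * poch q q n * poch (c * q) q (m +ℕ n)
      t = 1# - q * pow q n
      D≈ : D m (suc n) ≈ ((1# - c) * E) * t
      D≈ = trans (*-congˡ (trans (reflexive (P.cong (poch c q) (+-suc m n))) (poch-first c q (m +ℕ n))))
        (solve 5 (λ qm qn t u pc → qm :* (qn :* t) :* (u :* pc) := (u :* (qm :* qn :* pc)) :* t) refl
          (poch q q m) (poch q q n) t (1# - c) (poch (c * q) q (m +ℕ n)))

    -- The y-term over D(m,n); the factor 1 - q^n makes it vanish for n = 0.
    y-term : ∀ A m n →
      λy A * mulY (substXq q (Φy A)) m n
        ≈ (A * pow q m * (1# - pow q n) * poch (A * q) q (pred (m +ℕ n)) * poch b q m * poch b' q n) * D m n ⁻¹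
    y-term A m zero = trans (zeroʳ _) (sym (trans (*-congʳ (*-congʳ (*-congʳ (one-minus-one-* (A * pow q m) _)))) (solve 3 (λ u v d → (con 0 :* u :* v) :* d := con 0) refl _ _ _)))
    y-term A m (suc n) = trans (y-term-suc A m n)
      (*-congʳ (*-congʳ (*-congʳ (*-congˡ (reflexive (P.cong (λ N → poch (A * q) q (pred N)) (P.sym (+-suc m n))))))))

    contiguous : ∀ A →
      Φ1 q (A * q) b b' c ≋ ((Φ1 q A b b' c ⊕ scale (λx A) (mulX (Φx A))) ⊕ scale (λy A) (mulY (substXq q (Φy A))))
    contiguous A m n = begin
      (poch (A * q) q (m +ℕ n) * Bm * B') * Di
        ≈⟨ *-congʳ (*-congʳ (*-congʳ (trans (poch-difference A q (m +ℕ n)) (+-congˡ (*-congʳ (*-congˡ split-q^m+n)))))) ⟩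
      ((PA + A * ((1# - qm) + qm * (1# - qn)) * P') * Bm * B') * Di
        ≈⟨ solve 9 (λ pa a u qm v p bm b' d → ((pa :+ a :* (u :+ qm :* v) :* p) :* bm :* b') :* d := ((pa :* bm :* b') :* d :+ (a :* u :* p :* bm :* b') :* d) :+ (a :* qm :* v :* p :* bm :* b') :* d) refl PA A (1# - qm) qm (1# - qn) P' Bm B' Di ⟩
      ((PA * Bm * B') * Di + (A * (1# - qm) * P' * Bm * B') * Di) + (A * qm * (1# - qn) * P' * Bm * B') * Di
        ≈⟨ +-cong (+-congˡ (sym (x-term A m n))) (sym (y-term A m n)) ⟩
      (Φ1 q A b b' c m n + λx A * mulX (Φx A) m n) + λy A * mulY (substXq q (Φy A)) m n ∎
      where
      Bm = poch b q m
      B' = poch b' q n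
      Di = D m n ⁻¹
      PA = poch A q (m +ℕ n)
      P' = poch (A * q) q (pred (m +ℕ n))
      qm = pow q m
      qn = pow q n
      split-q^m+n : 1# - pow q (m +ℕ n) ≈ (1# - qm) + qm * (1# - qn)
      split-q^m+n = trans (+-congˡ (-‿cong (pow-+ q m n))) (sym (one-minus-product qm qn))

  module Iteration (q a b b' c : Carrier) (q≉0 : ¬ (q ≈ 0#))
                   (Qq≉0 : ∀ m → ¬ (poch q q m ≈ 0#))
                   (Cq≉0 : ∀ N → ¬ (poch c q N ≈ 0#)) where
    open Contiguous q b b' c Qq≉0 Cq≉0

    λx-* : ∀ p → λx (a * p) ≈ λx a * p
    λx-* p = solve 4 (λ a p u ci → ((a :* p) :* u) :* ci := ((a :* u) :* ci) :* p) refl a p (1# - b) ((1# - c) ⁻¹)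

    λy-* : ∀ p → λy (a * p) ≈ λy a * p
    λy-* p = solve 4 (λ a p u ci → ((a :* p) :* u) :* ci := ((a :* u) :* ci) :* p) refl a p (1# - b') ((1# - c) ⁻¹)

    Sx Sy : ℕ → PS
    Sx n = sumFrom1 n (λ k → scale (pow q (k ∸ 1)) (Φ1 q (a * pow q k) (b * q) b' (c * q)))
    Sy n = sumFrom1 n (λ k → scale (pow q (k ∸ 1)) (substXq q (Φ1 q (a * pow q k) b (b' * q) (c * q))))

    Tx Ty : ℕ → PS
    Tx n = sumFrom1 n (λ k → scale (pow (q ⁻¹) k) (Φ1 q (a * q * pow (q ⁻¹) k) (b * q) b' (c * q)))
    Ty n = sumFrom1 n (λ k → scale (pow (q ⁻¹) k) (substXq q (Φ1 q (a * q * pow (q ⁻¹) k) b (b' * q) (c * q))))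

    ascending : ∀ n → Φ1 q (a * pow q n) b b' c ≋ ((Φ1 q a b b' c ⊕ scale (λx a) (mulX (Sx n))) ⊕ scale (λy a) (mulY (Sy n)))
    ascending zero m j = trans (Φ1-cong q b b' c (*-identityʳ a) m j)
      (sym (trans (+-cong (trans (+-congˡ (scale-mulX-zero (λx a) m j)) (+-identityʳ _)) (scale-mulY-zero (λy a) m j))
                  (+-identityʳ _)))
    ascending (suc n) m j = begin
      Φ1 q (a * pow q (suc n)) b b' c m j
        ≈⟨ Φ1-cong q b b' c aq^n+1≈Aq m j ⟩
      Φ1 q (A * q) b b' c m j
        ≈⟨ contiguous A m j ⟩
      (Φ1 q A b b' c m j + λx A * X) + λy A * Y
        ≈⟨ +-cong (+-cong (ascending n m j) (*-congʳ (λx-* (pow q n)))) (*-congʳ (λy-* (pow q n))) ⟩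
      ((Φa + λx a * MX) + λy a * MY + (λx a * pow q n) * X) + (λy a * pow q n) * Y
        ≈⟨ solve 8 (λ φ sx sy p mx my x y →
             ((φ :+ sx :* mx) :+ sy :* my :+ (sx :* p) :* x) :+ (sy :* p) :* y
             := (φ :+ sx :* (mx :+ p :* x)) :+ sy :* (my :+ p :* y))
             refl Φa (λx a) (λy a) (pow q n) MX MY X Y ⟩
      (Φa + λx a * (MX + pow q n * X)) + λy a * (MY + pow q n * Y)
        ≈⟨ +-cong (+-congˡ (*-congˡ (sym Sx-step))) (*-congˡ (sym Sy-step)) ⟩
      (Φa + λx a * mulX (Sx (suc n)) m j) + λy a * mulY (Sy (suc n)) m j ∎
      where
      A = a * pow q n
      Φa = Φ1 q a b b' c m j
      MX = mulX (Sx n) m j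
      MY = mulY (Sy n) m j
      X = mulX (Φx A) m j
      Y = mulY (substXq q (Φy A)) m j
      aq^n+1≈Aq : a * pow q (suc n) ≈ A * q
      aq^n+1≈Aq = solve 3 (λ a q qn → a :* (q :* qn) := (a :* qn) :* q) refl a q (pow q n)
      Sx-step : mulX (Sx (suc n)) m j ≈ MX + pow q n * X
      Sx-step = trans (mulX-⊕-scale (Sx n) _ (pow q n) m j)
        (+-congˡ (*-congˡ (mulX-cong (Φ1-cong q (b * q) b' (c * q) aq^n+1≈Aq) m j)))
      Sy-step : mulY (Sy (suc n)) m j ≈ MY + pow q n * Y
      Sy-step = trans (mulY-⊕-scale (Sy n) _ (pow q n) m j)
        (+-congˡ (*-congˡ (mulY-cong (substXq-cong q (Φ1-cong q b (b' * q) (c * q) aq^n+1≈Aq)) m j)))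

    descending : ∀ n → Φ1 q (a * pow (q ⁻¹) n) b b' c ≋ ((Φ1 q a b b' c ⊖ scale (λx a) (mulX (Tx n))) ⊖ scale (λy a) (mulY (Ty n)))
    descending zero m j = trans (Φ1-cong q b b' c (*-identityʳ a) m j)
      (sym (trans (+-cong (trans (+-congˡ (trans (-‿cong (scale-mulX-zero (λx a) m j)) -0#≈0#)) (+-identityʳ _))
                          (trans (-‿cong (scale-mulY-zero (λy a) m j)) -0#≈0#))
                  (+-identityʳ _)))
    descending (suc n) m j = begin
      Φ1 q A b b' c m j
        ≈⟨ solve-for-first _ _ _ _ (contiguous A m j) ⟩
      (Φ1 q (A * q) b b' c m j - λx A * X) - λy A * Y
        ≈⟨ +-congʳ (+-congʳ (trans (Φ1-cong q b b' c Aq≈aq⁻ⁿ m j) (descending n m j))) ⟩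
      (((Φa - λx a * MX) - λy a * MY) - λx A * X) - λy A * Y
        ≈⟨ solve 5 (λ φ n₁ n₂ n₃ n₄ → (((φ :+ n₁) :+ n₂) :+ n₃) :+ n₄ := (φ :+ (n₁ :+ n₃)) :+ (n₂ :+ n₄)) refl
             Φa (- (λx a * MX)) (- (λy a * MY)) (- (λx A * X)) (- (λy A * Y)) ⟩
      (Φa + (- (λx a * MX) + - (λx A * X))) + (- (λy a * MY) + - (λy A * Y))
        ≈⟨ +-cong (+-congˡ (sym (neg-distrib-scaled (λx a) p MX X (λx A) (λx-* p))))
                  (sym (neg-distrib-scaled (λy a) p MY Y (λy A) (λy-* p))) ⟩
      (Φa - λx a * (MX + p * X)) - λy a * (MY + p * Y)
        ≈⟨ +-cong (+-congˡ (-‿cong (*-congˡ (sym Tx-step)))) (-‿cong (*-congˡ (sym Ty-step))) ⟩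
      (Φa - λx a * mulX (Tx (suc n)) m j) - λy a * mulY (Ty (suc n)) m j ∎
      where
      q⁻ = q ⁻¹
      p = pow q⁻ (suc n)
      A = a * p
      Φa = Φ1 q a b b' c m j
      MX = mulX (Tx n) m j
      MY = mulY (Ty n) m j
      X = mulX (Φx A) m j
      Y = mulY (substXq q (Φy A)) m j
      Aq≈aq⁻ⁿ : A * q ≈ a * pow q⁻ n
      Aq≈aq⁻ⁿ = begin
        (a * (q⁻ * pow q⁻ n)) * q   ≈⟨ solve 4 (λ a qi qn q → (a :* (qi :* qn)) :* q := (a :* qn) :* (q :* qi)) refl a q⁻ (pow q⁻ n) q ⟩
        (a * pow q⁻ n) * (q * q⁻)   ≈⟨ *-congˡ (⁻¹-inverse q q≉0) ⟩
        (a * pow q⁻ n) * 1#         ≈⟨ *-identityʳ _ ⟩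
        a * pow q⁻ n ∎
      aqp≈Aq : a * q * p ≈ A * q
      aqp≈Aq = solve 3 (λ a q p → a :* q :* p := (a :* p) :* q) refl a q p
      Tx-step : mulX (Tx (suc n)) m j ≈ MX + p * X
      Tx-step = trans (mulX-⊕-scale (Tx n) _ p m j)
        (+-congˡ (*-congˡ (mulX-cong (Φ1-cong q (b * q) b' (c * q) aqp≈Aq) m j)))
      Ty-step : mulY (Ty (suc n)) m j ≈ MY + p * Y
      Ty-step = trans (mulY-⊕-scale (Ty n) _ p m j)
        (+-congˡ (*-congˡ (mulY-cong (substXq-cong q (Φ1-cong q b (b' * q) (c * q) aqp≈Aq)) m j)))

-- Both identities in fact hold for every n ≥ 0; the hypothesis 1 ≤ n is unused.
theorem1 : ∀ {c ℓ : Level} (F : Field c ℓ) →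
  let open Field F
      open QAppell F
  in (q a b b' c : Carrier) →
     ¬ (q ≈ 0#) →
     (∀ m → ¬ (poch q q m ≈ 0#)) →
     (∀ N → ¬ (poch c q N ≈ 0#)) →
     (n : ℕ) → 1 ≤ n →
     ((Φ1 q (a * pow q n) b b' c)
       ≋ ((Φ1 q a b b' c
           ⊕ scale ((a * (1# - b)) * (1# - c) ⁻¹)
               (mulX (sumFrom1 n (λ k → scale (pow q (k ∸ 1))
                  (Φ1 q (a * pow q k) (b * q) b' (c * q))))))
          ⊕ scale ((a * (1# - b')) * (1# - c) ⁻¹)
               (mulY (sumFrom1 n (λ k → scale (pow q (k ∸ 1))
                  (substXq q (Φ1 q (a * pow q k) b (b' * q) (c * q))))))))
     ×
     ((Φ1 q (a * pow (q ⁻¹) n) b b' c)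
       ≋ ((Φ1 q a b b' c
           ⊖ scale ((a * (1# - b)) * (1# - c) ⁻¹)
               (mulX (sumFrom1 n (λ k → scale (pow (q ⁻¹) k)
                  (Φ1 q (a * q * pow (q ⁻¹) k) (b * q) b' (c * q))))))
          ⊖ scale ((a * (1# - b')) * (1# - c) ⁻¹)
               (mulY (sumFrom1 n (λ k → scale (pow (q ⁻¹) k)
                  (substXq q (Φ1 q (a * q * pow (q ⁻¹) k) b (b' * q) (c * q))))))))
theorem1 F q a b b' c q≉0 Qq≉0 Cq≉0 n _ = ascending n , descending n
  where open Contiguity.Iteration F q a b b' c q≉0 Qq≉0 Cq≉0
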